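{- Let $\mathcal{D}=\{0,1,2\}$. The set of real numbers of the form \[ \tfrac{1}{2}\sum_{i=0}^{k}d_i\left(-\tfrac32\right)^i \qquad (k\in\mathbb{N},\; d_i\in\mathcal{D}) \] is equal to $\mathbb{Z}[\tfrac12]=\{a2^{ -\ell}\mid a\in\mathbb{Z},\ \ell\in\mathbb{N}\}$.
   Context: $\mathbb{N}$ denotes the set of nonnegative integers. -}

module Defs where

open import Data.Nat using (ℕ; zero; suc)
open import Data.Fin using (Fin; toℕ)
import Data.Fin as Fin
open import Data.Integer using (ℤ; +_; -[1+_])
open import Data.Rational using (ℚ; _+_; _*_; _/_; 0ℚ; 1ℚ)
open import Data.Product using (∃)
open import Relation.Binary.PropositionalEquality using (_≡_)

_^_ : ℚ → ℕ → ℚ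
p ^ zero = 1ℚ
p ^ suc n = p * (p ^ n)

sumFin : (n : ℕ) → (Fin n → ℚ) → ℚ
sumFin zero f = 0ℚ
sumFin (suc n) f = f Fin.zero + sumFin n (λ i → f (Fin.suc i))

digitℚ : Fin 3 → ℚ
digitℚ d = (+ toℕ d) / 1

minusThreeHalves : ℚ
minusThreeHalves = -[1+ 2 ] / 2

half : ℚ
half = (+ 1) / 2

value : (k : ℕ) → (Fin (suc k) → Fin 3) → ℚ
value k d = half * sumFin (suc k) (λ i → digitℚ (d i) * (minusThreeHalves ^ toℕ i))

Representable : ℚ → Set
Representable q =
  ∃ λ (k : ℕ) → ∃ λ (d : Fin (suc k) → Fin 3) → value k d ≡ q

InDyadic : ℚ → Set
InDyadic q =
  ∃ λ (a : ℤ) → ∃ λ (ℓ : ℕ) → (a / 1) * (half ^ ℓ) ≡ q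

module Submission where

-- Since ℤ[1/2] is a ring containing 1/2 and -3/2, every representable number is dyadic.
-- Conversely, it suffices to write each a/2^l as Σ dᵢ (-3/2)^i (then apply this to 2a).
-- Pick the digit e ∈ {0,1,2} with a ≡ e·2^l (mod 3) and write a = e·2^l + 3b; then
-- a/2^l = e + (-3/2)·(-2b/2^l). For l > 0 the second factor is -b/2^(l-1), which lowers l;
-- for l = 0 the integer -2b is smaller than a in absolute value as soon as |a| > 4, and the
-- nine integers with |a| ≤ 4 are expanded by hand.

open import Defs
open import Algebra.Bundles using (CommutativeMonoid)
open import Data.Fin as Fin using (Fin; toℕ; #_)
import Data.Fin.Properties as Fin
open import Data.Integer as ℤ using (ℤ; +_; -[1+_]; ∣_∣)
import Data.Integer.DivMod as ℤ
import Data.Integer.Properties as ℤ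
open import Data.Integer.Tactic.RingSolver using (solve-∀)
open import Data.Nat as ℕ using (ℕ; zero; suc; _≤_; _<_; z≤n; s≤s)
import Data.Nat.Properties as ℕ
open import Data.Product using (∃; _×_; _,_)
open import Data.Rational using (ℚ; _+_; _*_; _/_; 1ℚ; toℚᵘ)
import Data.Rational.Properties as ℚ
open import Data.Rational.Unnormalised as ℚᵘ using (mkℚᵘ)
import Data.Rational.Unnormalised.Properties as ℚᵘ
open import Data.Vec.Functional using (_∷_; [])
open import Relation.Binary.PropositionalEquality
open import Relation.Nullary using (yes; no; contradiction)
open import Algebra.Properties.CommutativeSemigroup
  (CommutativeMonoid.commutativeSemigroup ℚ.*-1-commutativeMonoid)
  using (interchange; x∙yz≈y∙xz)

fromℤ : ℤ → ℚ
fromℤ a = a / 1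

toℚᵘ-fromℤ : ∀ a → toℚᵘ (fromℤ a) ℚᵘ.≃ mkℚᵘ a 0
toℚᵘ-fromℤ a = ℚ.toℚᵘ-fromℚᵘ (mkℚᵘ a 0)

fromℤ-homo-+ : ∀ a b → fromℤ (a ℤ.+ b) ≡ fromℤ a + fromℤ b
fromℤ-homo-+ a b = ℚ.toℚᵘ-injective (begin
  toℚᵘ (fromℤ (a ℤ.+ b))              ≈⟨ toℚᵘ-fromℤ (a ℤ.+ b) ⟩
  mkℚᵘ (a ℤ.+ b) 0                    ≡⟨ cong (λ c → mkℚᵘ c 0) (sym (cong₂ ℤ._+_ (ℤ.*-identityʳ a) (ℤ.*-identityʳ b))) ⟩
  mkℚᵘ a 0 ℚᵘ.+ mkℚᵘ b 0              ≈⟨ ℚᵘ.+-cong (toℚᵘ-fromℤ a) (toℚᵘ-fromℤ b) ⟨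
  toℚᵘ (fromℤ a) ℚᵘ.+ toℚᵘ (fromℤ b)  ≈⟨ ℚ.toℚᵘ-homo-+ (fromℤ a) (fromℤ b) ⟨
  toℚᵘ (fromℤ a + fromℤ b)            ∎)
  where open ℚᵘ.≃-Reasoning

fromℤ-homo-* : ∀ a b → fromℤ (a ℤ.* b) ≡ fromℤ a * fromℤ b
fromℤ-homo-* a b = ℚ.toℚᵘ-injective (begin
  toℚᵘ (fromℤ (a ℤ.* b))              ≈⟨ toℚᵘ-fromℤ (a ℤ.* b) ⟩
  mkℚᵘ a 0 ℚᵘ.* mkℚᵘ b 0              ≈⟨ ℚᵘ.*-cong (toℚᵘ-fromℤ a) (toℚᵘ-fromℤ b) ⟨
  toℚᵘ (fromℤ a) ℚᵘ.* toℚᵘ (fromℤ b)  ≈⟨ ℚ.toℚᵘ-homo-* (fromℤ a) (fromℤ b) ⟨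
  toℚᵘ (fromℤ a * fromℤ b)            ∎)
  where open ℚᵘ.≃-Reasoning

^-distribˡ-+-* : ∀ x m n → x ^ (m ℕ.+ n) ≡ x ^ m * x ^ n
^-distribˡ-+-* x zero    n = sym (ℚ.*-identityˡ (x ^ n))
^-distribˡ-+-* x (suc m) n =
  trans (cong (x *_) (^-distribˡ-+-* x m n)) (sym (ℚ.*-assoc x (x ^ m) (x ^ n)))

infix 8 2^_
2^_ : ℕ → ℤ
2^ zero  = + 1
2^ suc n = + 2 ℤ.* 2^ n

2*half≡1 : fromℤ (+ 2) * half ≡ 1ℚ
2*half≡1 = refl

2^*half^≡1 : ∀ n → fromℤ (2^ n) * half ^ n ≡ 1ℚ
2^*half^≡1 zero    = refl
2^*half^≡1 (suc n) = begin
  fromℤ (+ 2 ℤ.* 2^ n) * (half * half ^ n)          ≡⟨ cong (_* (half * half ^ n)) (fromℤ-homo-* (+ 2) (2^ n)) ⟩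
  (fromℤ (+ 2) * fromℤ (2^ n)) * (half * half ^ n)  ≡⟨ interchange (fromℤ (+ 2)) (fromℤ (2^ n)) half (half ^ n) ⟩
  (fromℤ (+ 2) * half) * (fromℤ (2^ n) * half ^ n)  ≡⟨ cong₂ _*_ 2*half≡1 (2^*half^≡1 n) ⟩
  1ℚ * 1ℚ                                           ≡⟨⟩
  1ℚ                                                ∎
  where open ≡-Reasoning

dyadic : ℤ → ℕ → ℚ
dyadic a l = fromℤ a * half ^ l

dyadic-homo-+ : ∀ a b l → dyadic (a ℤ.+ b) l ≡ dyadic a l + dyadic b l
dyadic-homo-+ a b l =
  trans (cong (_* half ^ l) (fromℤ-homo-+ a b)) (ℚ.*-distribʳ-+ (half ^ l) (fromℤ a) (fromℤ b))

dyadic-homo-* : ∀ a b l n → dyadic (a ℤ.* b) (l ℕ.+ n) ≡ dyadic a l * dyadic b n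
dyadic-homo-* a b l n = begin
  fromℤ (a ℤ.* b) * half ^ (l ℕ.+ n)               ≡⟨ cong₂ _*_ (fromℤ-homo-* a b) (^-distribˡ-+-* half l n) ⟩
  (fromℤ a * fromℤ b) * (half ^ l * half ^ n)      ≡⟨ interchange (fromℤ a) (fromℤ b) (half ^ l) (half ^ n) ⟩
  (fromℤ a * half ^ l) * (fromℤ b * half ^ n)      ∎
  where open ≡-Reasoning

dyadic-*2^ : ∀ a l n → dyadic (a ℤ.* 2^ n) (l ℕ.+ n) ≡ dyadic a l
dyadic-*2^ a l n = begin
  dyadic (a ℤ.* 2^ n) (l ℕ.+ n)  ≡⟨ dyadic-homo-* a (2^ n) l n ⟩
  dyadic a l * dyadic (2^ n) n   ≡⟨ cong (dyadic a l *_) (2^*half^≡1 n) ⟩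
  dyadic a l * 1ℚ                ≡⟨ ℚ.*-identityʳ (dyadic a l) ⟩
  dyadic a l                     ∎
  where open ≡-Reasoning

dyadic-double : ∀ a l → dyadic (+ 2 ℤ.* a) (suc l) ≡ dyadic a l
dyadic-double a l =
  trans (cong₂ dyadic (ℤ.*-comm (+ 2) a) (ℕ.+-comm 1 l)) (dyadic-*2^ a l 1)

half*dyadic : ∀ a l → half * dyadic a l ≡ dyadic a (suc l)
half*dyadic a l = x∙yz≈y∙xz half (fromℤ a) (half ^ l)

InDyadic-fromℤ : ∀ a → InDyadic (fromℤ a)
InDyadic-fromℤ a = a , 0 , ℚ.*-identityʳ (fromℤ a)

InDyadic-+ : ∀ {x y} → InDyadic x → InDyadic y → InDyadic (x + y)
InDyadic-+ (a , l , refl) (b , n , refl) = a ℤ.* 2^ n ℤ.+ b ℤ.* 2^ l , l ℕ.+ n , (begin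
  dyadic (a ℤ.* 2^ n ℤ.+ b ℤ.* 2^ l) (l ℕ.+ n)
    ≡⟨ dyadic-homo-+ (a ℤ.* 2^ n) (b ℤ.* 2^ l) (l ℕ.+ n) ⟩
  dyadic (a ℤ.* 2^ n) (l ℕ.+ n) + dyadic (b ℤ.* 2^ l) (l ℕ.+ n)
    ≡⟨ cong (_+_ (dyadic (a ℤ.* 2^ n) (l ℕ.+ n))) (cong (dyadic (b ℤ.* 2^ l)) (ℕ.+-comm l n)) ⟩
  dyadic (a ℤ.* 2^ n) (l ℕ.+ n) + dyadic (b ℤ.* 2^ l) (n ℕ.+ l)
    ≡⟨ cong₂ _+_ (dyadic-*2^ a l n) (dyadic-*2^ b n l) ⟩
  dyadic a l + dyadic b n
    ∎)
  where open ≡-Reasoning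

InDyadic-* : ∀ {x y} → InDyadic x → InDyadic y → InDyadic (x * y)
InDyadic-* (a , l , refl) (b , n , refl) = a ℤ.* b , l ℕ.+ n , dyadic-homo-* a b l n

InDyadic-^ : ∀ {x} → InDyadic x → ∀ n → InDyadic (x ^ n)
InDyadic-^ x∈D zero    = InDyadic-fromℤ (+ 1)
InDyadic-^ x∈D (suc n) = InDyadic-* x∈D (InDyadic-^ x∈D n)

InDyadic-sumFin : ∀ n {f : Fin n → ℚ} → (∀ i → InDyadic (f i)) → InDyadic (sumFin n f)
InDyadic-sumFin zero    f∈D = InDyadic-fromℤ (+ 0)
InDyadic-sumFin (suc n) f∈D = InDyadic-+ (f∈D Fin.zero) (InDyadic-sumFin n (λ i → f∈D (Fin.suc i)))

Representable⇒InDyadic : ∀ {q} → Representable q → InDyadic q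
Representable⇒InDyadic (k , d , refl) =
  InDyadic-* half∈D (InDyadic-sumFin (suc k) (λ i →
    InDyadic-* (InDyadic-fromℤ (+ toℕ (d i))) (InDyadic-^ -3/2∈D (toℕ i))))
  where
  half∈D : InDyadic half
  half∈D = + 1 , 1 , refl
  -3/2∈D : InDyadic minusThreeHalves
  -3/2∈D = -[1+ 2 ] , 1 , refl

digitSum : (k : ℕ) → (Fin (suc k) → Fin 3) → ℚ
digitSum k d = sumFin (suc k) (λ i → digitℚ (d i) * minusThreeHalves ^ toℕ i)

IsDigitSum : ℚ → Set
IsDigitSum x = ∃ λ (k : ℕ) → ∃ λ (d : Fin (suc k) → Fin 3) → digitSum k d ≡ x

sumFin-cong : ∀ n {f g : Fin n → ℚ} → (∀ i → f i ≡ g i) → sumFin n f ≡ sumFin n g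
sumFin-cong zero    f≗g = refl
sumFin-cong (suc n) f≗g = cong₂ _+_ (f≗g Fin.zero) (sumFin-cong n (λ i → f≗g (Fin.suc i)))

*-distribˡ-sumFin : ∀ n x (f : Fin n → ℚ) → sumFin n (λ i → x * f i) ≡ x * sumFin n f
*-distribˡ-sumFin zero    x f = sym (ℚ.*-zeroʳ x)
*-distribˡ-sumFin (suc n) x f = begin
  x * f Fin.zero + sumFin n (λ i → x * f (Fin.suc i))  ≡⟨ cong (_+_ (x * f Fin.zero)) (*-distribˡ-sumFin n x (λ i → f (Fin.suc i))) ⟩
  x * f Fin.zero + x * sumFin n (λ i → f (Fin.suc i))  ≡⟨ ℚ.*-distribˡ-+ x (f Fin.zero) _ ⟨
  x * sumFin (suc n) f                                 ∎
  where open ≡-Reasoning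

IsDigitSum-prepend : ∀ e {y} → IsDigitSum y → IsDigitSum (digitℚ e + minusThreeHalves * y)
IsDigitSum-prepend e (k , d , refl) = suc k , e ∷ d , cong₂ _+_ (ℚ.*-identityʳ (digitℚ e)) (begin
  sumFin (suc k) (λ i → digitℚ (d i) * (minusThreeHalves * minusThreeHalves ^ toℕ i))
    ≡⟨ sumFin-cong (suc k) (λ i → x∙yz≈y∙xz (digitℚ (d i)) minusThreeHalves (minusThreeHalves ^ toℕ i)) ⟩
  sumFin (suc k) (λ i → minusThreeHalves * (digitℚ (d i) * minusThreeHalves ^ toℕ i))
    ≡⟨ *-distribˡ-sumFin (suc k) minusThreeHalves (λ i → digitℚ (d i) * minusThreeHalves ^ toℕ i) ⟩
  minusThreeHalves * digitSum k d
    ∎)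
  where open ≡-Reasoning

-- 2 ≡ -1 (mod 3): a decomposition of -a at level l is one of a at level l + 1.
digit-decomposition : ∀ l a → ∃ λ (e : Fin 3) → ∃ λ b → a ≡ + toℕ e ℤ.* 2^ l ℤ.+ + 3 ℤ.* b
digit-decomposition zero a = e , a ℤ./ℕ 3 , (begin
  a                                      ≡⟨ ℤ.a≡a%ℕn+[a/ℕn]*n a 3 ⟩
  + (a ℤ.%ℕ 3) ℤ.+ a ℤ./ℕ 3 ℤ.* + 3      ≡⟨ cong (λ r → + r ℤ.+ a ℤ./ℕ 3 ℤ.* + 3) (Fin.toℕ-fromℕ< r<3) ⟨
  + toℕ e ℤ.+ a ℤ./ℕ 3 ℤ.* + 3           ≡⟨ cong₂ ℤ._+_ (ℤ.*-identityʳ (+ toℕ e)) (ℤ.*-comm (+ 3) (a ℤ./ℕ 3)) ⟨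
  + toℕ e ℤ.* + 1 ℤ.+ + 3 ℤ.* (a ℤ./ℕ 3)  ∎)
  where
  open ≡-Reasoning
  r<3 : a ℤ.%ℕ 3 < 3
  r<3 = ℤ.n%ℕd<d a 3
  e : Fin 3
  e = Fin.fromℕ< r<3
digit-decomposition (suc l) a with digit-decomposition l (ℤ.- a)
... | e , b , -a≡ = e , ℤ.- (+ toℕ e ℤ.* 2^ l ℤ.+ b) , (begin
  a                                         ≡⟨ ℤ.neg-involutive a ⟨
  ℤ.- (ℤ.- a)                               ≡⟨ cong ℤ.-_ -a≡ ⟩
  ℤ.- (+ toℕ e ℤ.* 2^ l ℤ.+ + 3 ℤ.* b)      ≡⟨ negate (+ toℕ e) (2^ l) b ⟩
  + toℕ e ℤ.* 2^ suc l ℤ.+ + 3 ℤ.* ℤ.- (+ toℕ e ℤ.* 2^ l ℤ.+ b) ∎)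
  where
  open ≡-Reasoning
  negate : ∀ x p b → ℤ.- (x ℤ.* p ℤ.+ + 3 ℤ.* b) ≡ x ℤ.* (+ 2 ℤ.* p) ℤ.+ + 3 ℤ.* ℤ.- (x ℤ.* p ℤ.+ b)
  negate = solve-∀

2∣b∣<∣x+3b∣ : ∀ x b → ∣ x ∣ ≤ 2 → 4 < ∣ x ℤ.+ + 3 ℤ.* b ∣ → 2 ℕ.* ∣ b ∣ < ∣ x ℤ.+ + 3 ℤ.* b ∣
2∣b∣<∣x+3b∣ x b ∣x∣≤2 4<A = ℕ.*-cancelˡ-< 3 (2 ℕ.* ∣ b ∣) A (begin-strict
  3 ℕ.* (2 ℕ.* ∣ b ∣)  ≡⟨ trans (sym (ℕ.*-assoc 3 2 ∣ b ∣)) (ℕ.*-assoc 2 3 ∣ b ∣) ⟩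
  2 ℕ.* (3 ℕ.* ∣ b ∣)  ≤⟨ ℕ.*-monoʳ-≤ 2 3∣b∣≤A+2 ⟩
  2 ℕ.* (A ℕ.+ 2)      ≡⟨ ℕ.*-distribˡ-+ 2 A 2 ⟩
  2 ℕ.* A ℕ.+ 4        <⟨ ℕ.+-monoʳ-< (2 ℕ.* A) 4<A ⟩
  2 ℕ.* A ℕ.+ A        ≡⟨ ℕ.+-comm (2 ℕ.* A) A ⟩
  3 ℕ.* A              ∎)
  where
  open ℕ.≤-Reasoning
  A = ∣ x ℤ.+ + 3 ℤ.* b ∣
  3b≡[x+3b]-x : ∀ x b → + 3 ℤ.* b ≡ (x ℤ.+ + 3 ℤ.* b) ℤ.- x
  3b≡[x+3b]-x = solve-∀
  3∣b∣≤A+2 : 3 ℕ.* ∣ b ∣ ≤ A ℕ.+ 2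
  3∣b∣≤A+2 = begin
    3 ℕ.* ∣ b ∣                        ≡⟨ ℤ.abs-* (+ 3) b ⟨
    ∣ + 3 ℤ.* b ∣                      ≡⟨ cong ∣_∣ (3b≡[x+3b]-x x b) ⟩
    ∣ (x ℤ.+ + 3 ℤ.* b) ℤ.- x ∣        ≤⟨ ℤ.∣i-j∣≤∣i∣+∣j∣ (x ℤ.+ + 3 ℤ.* b) x ⟩
    A ℕ.+ ∣ x ∣                        ≤⟨ ℕ.+-monoʳ-≤ A ∣x∣≤2 ⟩
    A ℕ.+ 2                            ∎

IsDigitSum-small : ∀ a → ∣ a ∣ ≤ 4 → IsDigitSum (dyadic a 0)
IsDigitSum-small (+ 0) _ = 0 , # 0 ∷ [] , refl
IsDigitSum-small (+ 1) _ = 0 , # 1 ∷ [] , refl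
IsDigitSum-small (+ 2) _ = 0 , # 2 ∷ [] , refl
IsDigitSum-small (+ 3) _ = 2 , # 0 ∷ # 1 ∷ # 2 ∷ [] , refl
IsDigitSum-small (+ 4) _ = 2 , # 1 ∷ # 1 ∷ # 2 ∷ [] , refl
IsDigitSum-small (+ suc (suc (suc (suc (suc _))))) (s≤s (s≤s (s≤s (s≤s ()))))
IsDigitSum-small -[1+ 0 ] _ = 1 , # 2 ∷ # 2 ∷ [] , refl
IsDigitSum-small -[1+ 1 ] _ = 1 , # 1 ∷ # 2 ∷ [] , refl
IsDigitSum-small -[1+ 2 ] _ = 1 , # 0 ∷ # 2 ∷ [] , refl
IsDigitSum-small -[1+ 3 ] _ = 3 , # 2 ∷ # 1 ∷ # 1 ∷ # 2 ∷ [] , refl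
IsDigitSum-small -[1+ suc (suc (suc (suc _))) ] (s≤s (s≤s (s≤s (s≤s ()))))

minusThreeHalves*double : ∀ c → minusThreeHalves * fromℤ (+ 2 ℤ.* c) ≡ fromℤ (-[1+ 2 ] ℤ.* c)
minusThreeHalves*double c = begin
  minusThreeHalves * fromℤ (+ 2 ℤ.* c)          ≡⟨ cong (minusThreeHalves *_) (fromℤ-homo-* (+ 2) c) ⟩
  minusThreeHalves * (fromℤ (+ 2) * fromℤ c)    ≡⟨ ℚ.*-assoc minusThreeHalves (fromℤ (+ 2)) (fromℤ c) ⟨
  (minusThreeHalves * fromℤ (+ 2)) * fromℤ c    ≡⟨⟩
  fromℤ -[1+ 2 ] * fromℤ c                      ≡⟨ fromℤ-homo-* -[1+ 2 ] c ⟨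
  fromℤ (-[1+ 2 ] ℤ.* c)                        ∎
  where open ≡-Reasoning

dyadic-peel : ∀ (e : Fin 3) b l →
  dyadic (+ toℕ e ℤ.* 2^ l ℤ.+ + 3 ℤ.* b) l ≡ digitℚ e + minusThreeHalves * dyadic (+ 2 ℤ.* ℤ.- b) l
dyadic-peel e b l = begin
  dyadic (+ toℕ e ℤ.* 2^ l ℤ.+ + 3 ℤ.* b) l
    ≡⟨ dyadic-homo-+ (+ toℕ e ℤ.* 2^ l) (+ 3 ℤ.* b) l ⟩
  dyadic (+ toℕ e ℤ.* 2^ l) l + dyadic (+ 3 ℤ.* b) l
    ≡⟨ cong₂ _+_ (trans (dyadic-*2^ (+ toℕ e) 0 l) (ℚ.*-identityʳ (digitℚ e))) (cong (λ c → dyadic c l) (3b≡-3*-b b)) ⟩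
  digitℚ e + dyadic (-[1+ 2 ] ℤ.* ℤ.- b) l
    ≡⟨ cong (λ x → digitℚ e + x * half ^ l) (minusThreeHalves*double (ℤ.- b)) ⟨
  digitℚ e + minusThreeHalves * fromℤ (+ 2 ℤ.* ℤ.- b) * half ^ l
    ≡⟨ cong (_+_ (digitℚ e)) (ℚ.*-assoc minusThreeHalves (fromℤ (+ 2 ℤ.* ℤ.- b)) (half ^ l)) ⟩
  digitℚ e + minusThreeHalves * dyadic (+ 2 ℤ.* ℤ.- b) l
    ∎
  where
  open ≡-Reasoning
  3b≡-3*-b : ∀ b → + 3 ℤ.* b ≡ -[1+ 2 ] ℤ.* ℤ.- b
  3b≡-3*-b = solve-∀

IsDigitSum-integer : ∀ n a → ∣ a ∣ ≤ n → IsDigitSum (dyadic a 0)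
IsDigitSum-integer n a ∣a∣≤n with ∣ a ∣ ℕ.≤? 4
... | yes ∣a∣≤4 = IsDigitSum-small a ∣a∣≤4
IsDigitSum-integer zero a ∣a∣≤0 | no ∣a∣≰4 = contradiction (ℕ.≤-trans ∣a∣≤0 z≤n) ∣a∣≰4
IsDigitSum-integer (suc n) a ∣a∣≤1+n | no ∣a∣≰4 with digit-decomposition 0 a
... | e , b , refl = subst IsDigitSum (sym (dyadic-peel e b 0))
  (IsDigitSum-prepend e (IsDigitSum-integer n (+ 2 ℤ.* ℤ.- b) (ℕ.<⇒≤pred (ℕ.<-≤-trans smaller ∣a∣≤1+n))))
  where
  digit≤2 : ∀ (d : Fin 3) → ∣ + toℕ d ℤ.* 2^ 0 ∣ ≤ 2
  digit≤2 Fin.zero                     = z≤n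
  digit≤2 (Fin.suc Fin.zero)           = s≤s z≤n
  digit≤2 (Fin.suc (Fin.suc Fin.zero)) = s≤s (s≤s z≤n)
  smaller : ∣ + 2 ℤ.* ℤ.- b ∣ < ∣ a ∣
  smaller = subst (_< ∣ a ∣) (sym (trans (ℤ.abs-* (+ 2) (ℤ.- b)) (cong (2 ℕ.*_) (ℤ.∣-i∣≡∣i∣ b))))
    (2∣b∣<∣x+3b∣ (+ toℕ e ℤ.* 2^ 0) b (digit≤2 e) (ℕ.≰⇒> ∣a∣≰4))

IsDigitSum-dyadic : ∀ l a → IsDigitSum (dyadic a l)
IsDigitSum-dyadic zero    a = IsDigitSum-integer ∣ a ∣ a ℕ.≤-refl
IsDigitSum-dyadic (suc l) a with digit-decomposition (suc l) a
... | e , b , refl = subst IsDigitSum (sym (begin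
  dyadic (+ toℕ e ℤ.* 2^ suc l ℤ.+ + 3 ℤ.* b) (suc l)          ≡⟨ dyadic-peel e b (suc l) ⟩
  digitℚ e + minusThreeHalves * dyadic (+ 2 ℤ.* ℤ.- b) (suc l)  ≡⟨ cong (λ x → digitℚ e + minusThreeHalves * x) (dyadic-double (ℤ.- b) l) ⟩
  digitℚ e + minusThreeHalves * dyadic (ℤ.- b) l                ∎))
  (IsDigitSum-prepend e (IsDigitSum-dyadic l (ℤ.- b)))
  where open ≡-Reasoning

InDyadic⇒Representable : ∀ {q} → InDyadic q → Representable q
InDyadic⇒Representable (a , l , refl) with IsDigitSum-dyadic l (+ 2 ℤ.* a)
... | k , d , digitSum≡ = k , d , (begin
  half * digitSum k d             ≡⟨ cong (half *_) digitSum≡ ⟩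
  half * dyadic (+ 2 ℤ.* a) l     ≡⟨ half*dyadic (+ 2 ℤ.* a) l ⟩
  dyadic (+ 2 ℤ.* a) (suc l)      ≡⟨ dyadic-double a l ⟩
  dyadic a l                      ∎)
  where open ≡-Reasoning

theorem2 : (q : ℚ) → (Representable q → InDyadic q) × (InDyadic q → Representable q)
theorem2 q = Representable⇒InDyadic , InDyadic⇒Representable
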